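{- Let $m$ and $n$ be nonnegative integers with $m < n$. Then (a) $$o_S(n) \ge \frac{o_S(m) + a_S(m) + o_S(n-m-1) + a_S(n-m-1)}{2};$$ (b) if $n-m-1$ is positive, $$a_S(n) \ge \frac{o_S(m) + a_S(m) + i_S(n-m-1) + a_S(n-m-1)}{2}.$$
   Context: Seating process: seats and napkins alternate; diners are seated one at a time in empty seats chosen by the maître d' (who observes all napkin choices); each diner takes an available adjacent napkin (uniformly at random independently if both adjacent napkins are available, the unique one if exactly one is, none otherwise, in which case the diner is napkinless). An empty seat and an available napkin are neighbors if they are adjacent. The long trap setting strategy $S$: (S1) if some available napkin neighbors exactly one empty seat, seat the next diner in that empty seat; (S2) otherwise, if there is an empty seat $X$ three seats away from an occupied seat with the two seats strictly between them both empty, seat the next diner in such an $X$; if there is no such seat, seat the next diner in any empty seat. For $n \ge 1$, consider a row of $n$ consecutive empty seats $s_1,\dots,s_n$ with an available napkin between $s_j$ and $s_{j+1}$ for each $j$, flanked on both sides by occupied seats (as arises for a maximal run of empty seats on a circular table during play); each of the two boundary napkins (between $s_1$ and the left occupied seat, and between $s_n$ and the right occupied seat) is either available or already taken. The row is inner-facing if both boundary napkins are taken, outer-facing if both are available, and asymmetric if exactly one is available. Let $i_S(n)$, $o_S(n)$, $a_S(n)$ denote the expected number of diners seated in $s_1,\dots,s_n$ who receive no napkin when these seats are filled according to $S$, for an inner-facing, outer-facing, respectively asymmetric row of length $n$. By convention $a_S(0) = 0$ and $o_S(0) = 0$. -}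

module Defs where

open import Data.Bool using (Bool; true; false)
open import Data.Nat using (ℕ; zero; suc; _+_; _∸_)
open import Data.Fin using (Fin; toℕ; inject₁) renaming (suc to fsuc)
open import Data.Vec using (Vec; []; _∷_; lookup; replicate; _∷ʳ_; _[_]≔_)
open import Data.Maybe using (Maybe; just; nothing)
open import Data.Product using (Σ; _×_)
open import Data.Sum using (_⊎_)
open import Relation.Nullary using (¬_)
open import Relation.Binary.PropositionalEquality using (_≡_)
open import Data.Rational using (ℚ; 0ℚ; 1ℚ; ½) renaming (_+_ to _+q_; _*_ to _*q_)

-- A row of n seats s_1..s_n (positions 1..n), flanked by occupied seats at
-- positions 0 and n+1.  Napkin k (k = 0..n) lies between positions k and k+1.
-- occ  : seat i : Fin n (position toℕ i + 1) is occupied?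
-- nap  : napkin j : Fin (suc n) is available?
record State (n : ℕ) : Set where
  constructor st
  field
    occ : Vec Bool n
    nap : Vec Bool (suc n)
open State public

EmptySeat : {n : ℕ} → State n → Fin n → Set
EmptySeat s i = lookup (occ s) i ≡ false

EmptyPos : {n : ℕ} → State n → ℕ → Set
EmptyPos {n} s p = Σ (Fin n) λ i → (suc (toℕ i) ≡ p) × EmptySeat s i

NapAvail : {n : ℕ} → State n → Fin (suc n) → Set
NapAvail s j = lookup (nap s) j ≡ true

-- (S1) X is the unique empty neighbour of some available napkin.
-- Napkins adjacent to X are inject₁ X (left, between positions x-1 and x)
-- and fsuc X (right, between x and x+1), where x = toℕ X + 1.
S1Seat : {n : ℕ} → State n → Fin n → Set
S1Seat s X = EmptySeat s X ×
  ((NapAvail s (inject₁ X) × ¬ EmptyPos s (toℕ X))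
   ⊎ (NapAvail s (fsuc X) × ¬ EmptyPos s (toℕ X + 2)))

S1Applies : {n : ℕ} → State n → Set
S1Applies {n} s = Σ (Fin n) (S1Seat s)

S2Seat : {n : ℕ} → State n → Fin n → Set
S2Seat s X = EmptySeat s X ×
  ((EmptyPos s (x + 1) × EmptyPos s (x + 2) × ¬ EmptyPos s (x + 3))
   ⊎ (EmptyPos s (x ∸ 1) × EmptyPos s (x ∸ 2) × ¬ EmptyPos s (x ∸ 3)))
  where x = suc (toℕ X)

S2Applies : {n : ℕ} → State n → Set
S2Applies {n} s = Σ (Fin n) (S2Seat s)

HasEmpty : {n : ℕ} → State n → Set
HasEmpty {n} s = Σ (Fin n) (EmptySeat s)

Chooser : Set
Chooser = {n : ℕ} → State n → Maybe (Fin n)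

-- The policy follows strategy S (any tie-breaking allowed).
record FollowsS (c : Chooser) : Set where
  field
    picks-empty : {n : ℕ} (s : State n) → HasEmpty s →
                  Σ (Fin n) λ X → (c s ≡ just X) × EmptySeat s X
    rule-S1 : {n : ℕ} (s : State n) (X : Fin n) → S1Applies s →
              c s ≡ just X → S1Seat s X
    rule-S2 : {n : ℕ} (s : State n) (X : Fin n) → ¬ S1Applies s → S2Applies s →
              c s ≡ just X → S2Seat s X

occupy : {n : ℕ} → State n → Fin n → State n
occupy (st o k) X = st (o [ X ]≔ true) k

take : {n : ℕ} → State n → Fin (suc n) → State n
take (st o k) j = st o (k [ j ]≔ false)

-- Expected number of napkinless diners, with fuel bounding the number of
-- diners still to be seated (fuel = n suffices for a row of n seats).
expNapkinless : Chooser → (fuel : ℕ) → {n : ℕ} → State n → ℚ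
expNapkinless c zero s = 0ℚ
expNapkinless c (suc f) {n} s with c s
... | nothing = 0ℚ
... | just X with lookup (occ s) X
...   | true = 0ℚ
...   | false with lookup (nap s) (inject₁ X) | lookup (nap s) (fsuc X)
...     | true  | true  = ½ *q expNapkinless c f (take s' (inject₁ X))
                          +q ½ *q expNapkinless c f (take s' (fsuc X))
  where s' = occupy s X
...     | true  | false = expNapkinless c f (take (occupy s X) (inject₁ X))
...     | false | true  = expNapkinless c f (take (occupy s X) (fsuc X))
...     | false | false = 1ℚ +q expNapkinless c f (occupy s X)

-- Napkins of a fresh row: boundary napkins l (left) and r (right), inner ones available.
napRow : (n : ℕ) → Bool → Bool → Vec Bool (suc n)
napRow zero l r = l ∷ []
napRow (suc k) l r = l ∷ (replicate k true ∷ʳ r)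

row : (n : ℕ) → Bool → Bool → State n
row n l r = st (replicate n false) (napRow n l r)

iS oS aS : Chooser → ℕ → ℚ
iS c n = expNapkinless c n (row n false false)
oS c n = expNapkinless c n (row n true true)
aS c n = expNapkinless c n (row n true false)

module Submission where

-- Under S the expected number of napkinless diners of a row depends only on its length and
-- boundary napkins, whatever the tie-breaking: throughout play it equals the sum, over the
-- maximal runs of empty seats, of the values o, a, i of their lengths, where
-- o(k+1) = (o(k) + a(k))/2, a(k+1) = (a(k) + i(k))/2, i(1) = i(2) = i(3) = 1 and
-- i(k+4) = (3/2 + a(k+1) + i(k+1))/2, because every seating S permits preserves that sum in
-- expectation.  The two inequalities then read o(m+1) + o(k+1) ≤ o(k+m+1) and
-- o(m+1) + a(k+1) ≤ a(k+m+1); they follow by induction from i(n) - o(n) ∈ [23/32, 13/16]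
-- for n ≥ 3.

open import Defs

module RowValues where
  open import Data.Nat using (ℕ; zero; suc) renaming (_+_ to _+ℕ_)
  open import Data.Integer using (+_)
  open import Data.Rational using (ℚ; ½; _+_; _*_; _-_; _≤_; 0ℚ; 1ℚ; _/_)
  open import Data.Rational.Properties
  open import Data.Rational.Solver
  open import Data.Product using (_×_; _,_; proj₁)
  open import Data.Unit using (tt)
  open import Relation.Binary.PropositionalEquality
  open +-*-Solver
  open ≤-Reasoning

  ¼ ¾ ³⁄₂ : ℚ
  ¼ = + 1 / 4
  ¾ = + 3 / 4
  ³⁄₂ = + 3 / 2

  ½*-mono : {x y : ℚ} → x ≤ y → ½ * x ≤ ½ * y
  ½*-mono = *-monoˡ-≤-nonNeg ½

  ¼*-mono : {x y : ℚ} → x ≤ y → ¼ * x ≤ ¼ * y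
  ¼*-mono = *-monoˡ-≤-nonNeg ¼

  minus-mono-≤ : {p q a b : ℚ} → a ≤ p → q ≤ b → a - b ≤ p - q
  minus-mono-≤ a≤p q≤b = +-mono-≤ a≤p (neg-antimono-≤ q≤b)

  ≡+⇒+≤ : {x c : ℚ} (y d : ℚ) → x ≡ y + d → c ≤ d → y + c ≤ x
  ≡+⇒+≤ {x} {c} y d x≡y+d c≤d = begin
    y + c  ≤⟨ +-monoʳ-≤ y c≤d ⟩
    y + d  ≡⟨ x≡y+d ⟨
    x      ∎

  -- On a row of length k + 4 with both boundary napkins taken, (S1) does not apply and (S2)
  -- seats the diner third from an end; the two seats cut off form an inner-facing or an
  -- asymmetric row of length 2, of values 1 and ½, whence the constant 3/2.
  mutual
    outer asym inner : ℕ → ℚ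
    outer zero    = 0ℚ
    outer (suc k) = ½ * (outer k + asym k)

    asym zero    = 0ℚ
    asym (suc k) = ½ * (asym k + inner k)

    inner zero          = 0ℚ
    inner 1             = 1ℚ
    inner 2             = 1ℚ
    inner 3             = 1ℚ
    inner (suc (suc (suc (suc k)))) = ½ * (³⁄₂ + asym (suc k) + inner (suc k))

  gap : ℕ → ℚ
  gap n = inner n - outer n

  gap-rec : ∀ k → gap (4 +ℕ k) ≡ ¾ + ¼ * (gap (1 +ℕ k) - gap (2 +ℕ k))
  gap-rec k = solve 4 (λ o a i j →
      con ½ :* (con ³⁄₂ :+ a :+ i)
        :- con ½ :* (con ½ :* (con ½ :* (o :+ a) :+ con ½ :* (a :+ i)) :+ con ½ :* (con ½ :* (a :+ i) :+ j))
    := con ¾ :+ con ¼ :* ((i :- o) :- (j :- con ½ :* (o :+ a))))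
    refl (outer (suc k)) (asym (suc k)) (inner (suc k)) (inner (2 +ℕ k))

  InGapBand : ℚ → Set
  InGapBand x = (+ 23 / 32 ≤ x) × (x ≤ + 13 / 16)

  -- gap-rec maps the band into itself: ¾ ± (13/16 - 23/32)/4 lies in [23/32, 13/16].
  gap-inBand : ∀ n → InGapBand (gap (3 +ℕ n)) × InGapBand (gap (4 +ℕ n)) × InGapBand (gap (5 +ℕ n))
  gap-inBand zero = (≤ᵇ⇒≤ tt , ≤ᵇ⇒≤ tt) , (≤ᵇ⇒≤ tt , ≤ᵇ⇒≤ tt) , (≤ᵇ⇒≤ tt , ≤ᵇ⇒≤ tt)
  gap-inBand (suc n) with gap-inBand n
  ... | (lo₃ , hi₃) , (lo₄ , hi₄) , band₅ = (lo₄ , hi₄) , band₅ , (lower , upper)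
    where
    lower : + 23 / 32 ≤ gap (6 +ℕ n)
    lower = begin
      + 23 / 32                                ≤⟨ ≤ᵇ⇒≤ tt ⟩
      ¾ + ¼ * (+ 23 / 32 - + 13 / 16)          ≤⟨ +-monoʳ-≤ ¾ (¼*-mono (minus-mono-≤ lo₃ hi₄)) ⟩
      ¾ + ¼ * (gap (3 +ℕ n) - gap (4 +ℕ n))    ≡⟨ gap-rec (2 +ℕ n) ⟨
      gap (6 +ℕ n)                             ∎
    upper : gap (6 +ℕ n) ≤ + 13 / 16
    upper = begin
      gap (6 +ℕ n)                             ≡⟨ gap-rec (2 +ℕ n) ⟩
      ¾ + ¼ * (gap (3 +ℕ n) - gap (4 +ℕ n))    ≤⟨ +-monoʳ-≤ ¾ (¼*-mono (minus-mono-≤ hi₃ lo₄)) ⟩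
      ¾ + ¼ * (+ 13 / 16 - + 23 / 32)          ≤⟨ ≤ᵇ⇒≤ tt ⟩
      + 13 / 16                                ∎

  gap-≥ : ∀ n → + 23 / 32 ≤ gap (3 +ℕ n)
  gap-≥ n = proj₁ (proj₁ (gap-inBand n))

  gap-nonNeg : ∀ n → 0ℚ ≤ gap n
  gap-nonNeg 0 = ≤ᵇ⇒≤ tt
  gap-nonNeg 1 = ≤ᵇ⇒≤ tt
  gap-nonNeg 2 = ≤ᵇ⇒≤ tt
  gap-nonNeg (suc (suc (suc n))) = ≤-trans (≤ᵇ⇒≤ tt) (gap-≥ n)

  outer≤asym : ∀ n → outer n ≤ asym n
  outer≤asym zero    = ≤-refl
  outer≤asym (suc k) = begin
    outer (suc k)       ≡⟨ +-identityʳ (outer (suc k)) ⟨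
    outer (suc k) + 0ℚ  ≤⟨ ≡+⇒+≤ (outer (suc k)) (½ * gap k) asym≡outer+½gap (½*-mono (gap-nonNeg k)) ⟩
    asym (suc k)        ∎
    where
    asym≡outer+½gap : asym (suc k) ≡ outer (suc k) + ½ * gap k
    asym≡outer+½gap = solve 3 (λ o a i → con ½ :* (a :+ i) := con ½ :* (o :+ a) :+ con ½ :* (i :- o))
      refl (outer k) (asym k) (inner k)

  σ : ℕ → ℚ
  σ n = asym n + inner n

  σ-rec : ∀ k → σ (4 +ℕ k) ≡ ½ * σ (3 +ℕ k) + ½ * (³⁄₂ + σ (1 +ℕ k))
  σ-rec k = cong (λ t → ½ * σ (3 +ℕ k) + ½ * t) (+-assoc ³⁄₂ (asym (suc k)) (inner (suc k)))

  twoOuter : ℕ → ℚ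
  twoOuter m = outer m + outer m

  -- For k < 3, the excess in twoOuter+σ≤σ is a positive combination of gaps.
  σ-split₁ : ∀ m → σ (1 +ℕ m) ≡ twoOuter (suc m) + (½ * gap m + gap (1 +ℕ m))
  σ-split₁ m = solve 4 (λ o a i i₁ →
      con ½ :* (a :+ i) :+ i₁
    := (con ½ :* (o :+ a) :+ con ½ :* (o :+ a)) :+ (con ½ :* (i :- o) :+ (i₁ :- con ½ :* (o :+ a))))
    refl (outer m) (asym m) (inner m) (inner (1 +ℕ m))

  σ-split₂ : ∀ m → σ (2 +ℕ m) ≡ twoOuter (suc m) + (½ * gap (1 +ℕ m) + gap (2 +ℕ m) + ½ * gap m)
  σ-split₂ m = solve 5 (λ o a i i₁ i₂ →
      con ½ :* (con ½ :* (a :+ i) :+ i₁) :+ i₂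
    := (con ½ :* (o :+ a) :+ con ½ :* (o :+ a))
       :+ (con ½ :* (i₁ :- con ½ :* (o :+ a))
           :+ (i₂ :- con ½ :* (con ½ :* (o :+ a) :+ con ½ :* (a :+ i)))
           :+ con ½ :* (i :- o)))
    refl (outer m) (asym m) (inner m) (inner (1 +ℕ m)) (inner (2 +ℕ m))

  σ-split₃ : ∀ m → σ (3 +ℕ m) ≡ twoOuter (suc m) + (½ * gap (2 +ℕ m) + gap (3 +ℕ m) + ½ * gap (1 +ℕ m) + ½ * gap m)
  σ-split₃ m = solve 6 (λ o a i i₁ i₂ i₃ →
      con ½ :* (con ½ :* (con ½ :* (a :+ i) :+ i₁) :+ i₂) :+ i₃
    := (con ½ :* (o :+ a) :+ con ½ :* (o :+ a))
       :+ (con ½ :* (i₂ :- con ½ :* (con ½ :* (o :+ a) :+ con ½ :* (a :+ i)))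
           :+ (i₃ :- con ½ :* (con ½ :* (con ½ :* (o :+ a) :+ con ½ :* (a :+ i)) :+ con ½ :* (con ½ :* (a :+ i) :+ i₁)))
           :+ con ½ :* (i₁ :- con ½ :* (o :+ a))
           :+ con ½ :* (i :- o)))
    refl (outer m) (asym m) (inner m) (inner (1 +ℕ m)) (inner (2 +ℕ m)) (inner (3 +ℕ m))

  σ₁≤excess₁ : ∀ m → σ 1 ≤ ½ * gap m + gap (1 +ℕ m)
  σ₁≤excess₁ 0 = ≤ᵇ⇒≤ tt
  σ₁≤excess₁ 1 = ≤ᵇ⇒≤ tt
  σ₁≤excess₁ 2 = ≤ᵇ⇒≤ tt
  σ₁≤excess₁ (suc (suc (suc k))) = ≤-trans (≤ᵇ⇒≤ tt) (+-mono-≤ (½*-mono (gap-≥ k)) (gap-≥ (suc k)))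

  σ₂≤excess₂ : ∀ m → σ 2 ≤ ½ * gap (1 +ℕ m) + gap (2 +ℕ m) + ½ * gap m
  σ₂≤excess₂ 0 = ≤ᵇ⇒≤ tt
  σ₂≤excess₂ 1 = ≤ᵇ⇒≤ tt
  σ₂≤excess₂ (suc (suc j)) = begin
    σ 2                                                  ≤⟨ ≤ᵇ⇒≤ tt ⟩
    ½ * σ 2 + ¾                                          ≤⟨ +-monoˡ-≤ ¾ (½*-mono (σ₂≤excess₂ (suc j))) ⟩
    ½ * (½ * g₂ + g₃ + ½ * g₁) + ¾                       ≡⟨ solve 3 (λ g₁ g₂ g₃ →
         con ½ :* (con ½ :* g₂ :+ g₃ :+ con ½ :* g₁) :+ con ¾
      := con ½ :* g₃ :+ (con ¾ :+ con ¼ :* (g₁ :- g₂)) :+ con ½ :* g₂) refl g₁ g₂ g₃ ⟩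
    ½ * g₃ + (¾ + ¼ * (g₁ - g₂)) + ½ * g₂                ≡⟨ cong (λ t → ½ * g₃ + t + ½ * g₂) (gap-rec j) ⟨
    ½ * g₃ + gap (4 +ℕ j) + ½ * g₂                       ∎
    where
    g₁ g₂ g₃ : ℚ
    g₁ = gap (1 +ℕ j)
    g₂ = gap (2 +ℕ j)
    g₃ = gap (3 +ℕ j)

  σ₃≤excess₃ : ∀ m → σ 3 ≤ ½ * gap (2 +ℕ m) + gap (3 +ℕ m) + ½ * gap (1 +ℕ m) + ½ * gap m
  σ₃≤excess₃ 0 = ≤ᵇ⇒≤ tt
  σ₃≤excess₃ 1 = ≤ᵇ⇒≤ tt
  σ₃≤excess₃ 2 = ≤ᵇ⇒≤ tt
  σ₃≤excess₃ (suc (suc (suc k))) = ≤-trans (≤ᵇ⇒≤ tt)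
    (+-mono-≤ (+-mono-≤ (+-mono-≤ (½*-mono (gap-≥ (2 +ℕ k))) (gap-≥ (3 +ℕ k))) (½*-mono (gap-≥ (1 +ℕ k)))) (½*-mono (gap-≥ k)))

  mix-mono : ∀ {x y X Y} p t → p + x ≤ X → p + y ≤ Y → p + (½ * x + ½ * (t + y)) ≤ ½ * X + ½ * (t + Y)
  mix-mono {x} {y} {X} {Y} p t p+x≤X p+y≤Y = begin
    p + (½ * x + ½ * (t + y))        ≡⟨ solve 4 (λ p x y t →
         p :+ (con ½ :* x :+ con ½ :* (t :+ y)) := con ½ :* (p :+ x) :+ con ½ :* (t :+ (p :+ y))) refl p x y t ⟩
    ½ * (p + x) + ½ * (t + (p + y))  ≤⟨ +-mono-≤ (½*-mono p+x≤X) (½*-mono (+-monoʳ-≤ t p+y≤Y)) ⟩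
    ½ * X + ½ * (t + Y)              ∎

  twoOuter+σ≤σ : ∀ m k → twoOuter (suc m) + σ (suc k) ≤ σ (suc (k +ℕ m))
  twoOuter+σ≤σ m 0 = ≡+⇒+≤ (twoOuter (suc m)) _ (σ-split₁ m) (σ₁≤excess₁ m)
  twoOuter+σ≤σ m 1 = ≡+⇒+≤ (twoOuter (suc m)) _ (σ-split₂ m) (σ₂≤excess₂ m)
  twoOuter+σ≤σ m 2 = ≡+⇒+≤ (twoOuter (suc m)) _ (σ-split₃ m) (σ₃≤excess₃ m)
  twoOuter+σ≤σ m (suc (suc (suc j))) = begin
    twoOuter (suc m) + σ (4 +ℕ j)
      ≡⟨ cong (λ t → twoOuter (suc m) + t) (σ-rec j) ⟩
    twoOuter (suc m) + (½ * σ (3 +ℕ j) + ½ * (³⁄₂ + σ (1 +ℕ j)))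
      ≤⟨ mix-mono (twoOuter (suc m)) ³⁄₂ (twoOuter+σ≤σ m (suc (suc j))) (twoOuter+σ≤σ m j) ⟩
    ½ * σ (3 +ℕ (j +ℕ m)) + ½ * (³⁄₂ + σ (1 +ℕ (j +ℕ m)))
      ≡⟨ σ-rec (j +ℕ m) ⟨
    σ (4 +ℕ (j +ℕ m))  ∎

  outer+asym≤asym : ∀ m k → outer (suc m) + asym (suc k) ≤ asym (suc (k +ℕ m))
  outer+asym≤asym m zero = begin
    outer (suc m) + 0ℚ  ≡⟨ +-identityʳ (outer (suc m)) ⟩
    outer (suc m)       ≤⟨ outer≤asym (suc m) ⟩
    asym (suc m)        ∎
  outer+asym≤asym m (suc k) = begin
    outer (suc m) + ½ * σ (suc k)       ≡⟨ solve 2 (λ o s → o :+ con ½ :* s := con ½ :* ((o :+ o) :+ s)) refl (outer (suc m)) (σ (suc k)) ⟩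
    ½ * (twoOuter (suc m) + σ (suc k))  ≤⟨ ½*-mono (twoOuter+σ≤σ m k) ⟩
    ½ * σ (suc (k +ℕ m))                ∎

  outer-superadditive : ∀ m k → outer (suc m) + outer (suc k) ≤ outer (suc (k +ℕ m))
  outer-superadditive m zero = ≤-reflexive (+-identityʳ (outer (suc m)))
  outer-superadditive m (suc k) = begin
    outer (suc m) + ½ * (outer (suc k) + asym (suc k))
      ≡⟨ solve 3 (λ o p a → o :+ con ½ :* (p :+ a) := con ½ :* ((o :+ p) :+ (o :+ a))) refl (outer (suc m)) (outer (suc k)) (asym (suc k)) ⟩
    ½ * ((outer (suc m) + outer (suc k)) + (outer (suc m) + asym (suc k)))
      ≤⟨ ½*-mono (+-mono-≤ (outer-superadditive m k) (outer+asym≤asym m k)) ⟩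
    ½ * (outer (suc (k +ℕ m)) + asym (suc (k +ℕ m)))  ∎

  outer-split : ∀ m k → ½ * (outer m + asym m + outer k + asym k) ≤ outer (suc (k +ℕ m))
  outer-split m k = begin
    ½ * (outer m + asym m + outer k + asym k)        ≡⟨ solve 4 (λ o a o′ a′ → con ½ :* (o :+ a :+ o′ :+ a′) := con ½ :* (o :+ a) :+ con ½ :* (o′ :+ a′))
                                                          refl (outer m) (asym m) (outer k) (asym k) ⟩
    outer (suc m) + outer (suc k)                    ≤⟨ outer-superadditive m k ⟩
    outer (suc (k +ℕ m))                             ∎

  asym-split : ∀ m k → ½ * (outer m + asym m + inner k + asym k) ≤ asym (suc (k +ℕ m))
  asym-split m k = begin
    ½ * (outer m + asym m + inner k + asym k)        ≡⟨ solve 4 (λ o a i′ a′ → con ½ :* (o :+ a :+ i′ :+ a′) := con ½ :* (o :+ a) :+ con ½ :* (a′ :+ i′))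
                                                          refl (outer m) (asym m) (inner k) (asym k) ⟩
    outer (suc m) + asym (suc k)                     ≤⟨ outer+asym≤asym m k ⟩
    asym (suc (k +ℕ m))                              ∎

module Seating where
  open RowValues using (outer; asym; inner; ³⁄₂)
  open import Data.Bool using (Bool; true; false; not; _∧_; if_then_else_)
  open import Data.Nat using (ℕ; zero; suc; _≤_; _<_; z≤n; s≤s; _∸_; _<?_) renaming (_+_ to _+ℕ_)
  open import Data.Nat.Properties
    using (suc-injective; ≤-refl; ≤-trans; m≤m+n; m≤n+m; +-suc; +-comm; +-assoc; +-identityʳ; n<1+n; n≤1+n; ≤-pred; <⇒≢;
           ≤∧≢⇒<; <⇒≤; ≮⇒≥; m+[n∸m]≡n; m<m+n; >⇒≢; n≤0⇒n≡0; ≤-reflexive; ≤-<-trans; <-≤-trans; +-monoʳ-<; +-cancelˡ-<; <-cmp; +-monoʳ-≤)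
    renaming (_≟_ to _≟ℕ_)
  open import Data.Fin using (Fin; toℕ; inject₁; fromℕ<) renaming (suc to fsuc; zero to fzero)
  open import Data.Fin.Properties using (toℕ-fromℕ<; toℕ-inject₁; toℕ<n)
  open import Data.Vec using (Vec; []; _∷_; lookup; replicate; _∷ʳ_; _[_]≔_)
  open import Data.Rational using (ℚ; ½; _+_; _*_; _-_; 0ℚ; 1ℚ)
  open import Data.Rational.Properties using (+-inverseʳ) renaming (+-identityʳ to +ℚ-identityʳ)
  open import Data.Rational.Solver
  open import Data.Product using (Σ; _×_; _,_; proj₁; proj₂)
  open import Data.Sum using (_⊎_; inj₁; inj₂)
  open import Data.Empty using (⊥-elim)
  open import Data.Maybe using (just; nothing)
  open import Relation.Nullary using (¬_; yes; no; Dec)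
  open import Relation.Binary.Definitions using (tri<; tri≈; tri>)
  open import Relation.Binary.PropositionalEquality
  open import Function using (_∘_)
  open +-*-Solver

  -- Seat q of a row (position q + 1)
  -- has napkin q on its left and napkin q + 1 on its right; reading seats with default
  -- true and napkins with default false makes the right flank an occupied seat behind a
  -- taken napkin.
  at : ∀ {n} → Bool → Vec Bool n → ℕ → Bool
  at d []      q       = d
  at d (b ∷ v) zero    = b
  at d (b ∷ v) (suc q) = at d v q

  lookup≡at : ∀ {n} d (v : Vec Bool n) (i : Fin n) → lookup v i ≡ at d v (toℕ i)
  lookup≡at d (b ∷ v) fzero    = refl
  lookup≡at d (b ∷ v) (fsuc i) = lookup≡at d v i

  at-[]≔ : ∀ {n} d (v : Vec Bool n) (i : Fin n) b → at d (v [ i ]≔ b) (toℕ i) ≡ b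
  at-[]≔ d (x ∷ v) fzero    b = refl
  at-[]≔ d (x ∷ v) (fsuc i) b = at-[]≔ d v i b

  at-[]≔-other : ∀ {n} d (v : Vec Bool n) (i : Fin n) b q → q ≢ toℕ i → at d (v [ i ]≔ b) q ≡ at d v q
  at-[]≔-other d (x ∷ v) fzero    b zero    q≢i = ⊥-elim (q≢i refl)
  at-[]≔-other d (x ∷ v) fzero    b (suc q) q≢i = refl
  at-[]≔-other d (x ∷ v) (fsuc i) b zero    q≢i = refl
  at-[]≔-other d (x ∷ v) (fsuc i) b (suc q) q≢i = at-[]≔-other d v i b q (q≢i ∘ cong suc)

  at-beyond : ∀ {n} d (v : Vec Bool n) q → n ≤ q → at d v q ≡ d
  at-beyond d []      q       _         = refl
  at-beyond d (b ∷ v) (suc q) (s≤s n≤q) = at-beyond d v q n≤q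

  at≡not-default⇒< : ∀ {n} d (v : Vec Bool n) q → at d v q ≡ not d → q < n
  at≡not-default⇒< false []      q       ()
  at≡not-default⇒< true  []      q       ()
  at≡not-default⇒< d     (b ∷ v) zero    _  = s≤s z≤n
  at≡not-default⇒< d     (b ∷ v) (suc q) eq = s≤s (at≡not-default⇒< d v q eq)

  true≢false : true ≢ false
  true≢false ()

  occAt napAt : ∀ {n} → Vec Bool n → ℕ → Bool
  occAt = at true
  napAt = at false

  leftOcc : ∀ {n} → Vec Bool n → ℕ → Bool
  leftOcc v zero    = true
  leftOcc v (suc q) = occAt v q

  EmptyOn : ∀ {n} → Vec Bool n → ℕ → ℕ → Set
  EmptyOn v a len = ∀ t → t < len → occAt v (a +ℕ t) ≡ false

  run : ∀ {n} → Vec Bool n → ℕ → ℕ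
  run []           q       = 0
  run (b ∷ v)      (suc q) = run v q
  run (true ∷ v)   zero    = 0
  run (false ∷ v)  zero    = suc (run v zero)

  run-emptyOn : ∀ {n} (v : Vec Bool n) q → EmptyOn v q (run v q)
  run-emptyOn (b ∷ v)     (suc q) = run-emptyOn v q
  run-emptyOn (false ∷ v) zero zero    _         = refl
  run-emptyOn (false ∷ v) zero (suc t) (s≤s t<r) = run-emptyOn v zero t t<r

  run-end : ∀ {n} (v : Vec Bool n) q → occAt v (q +ℕ run v q) ≡ true
  run-end []          q       = refl
  run-end (b ∷ v)     (suc q) = run-end v q
  run-end (true ∷ v)  zero    = refl
  run-end (false ∷ v) zero    = run-end v zero

  run-occ : ∀ {n} (v : Vec Bool n) q → occAt v q ≡ true → run v q ≡ 0
  run-occ []          q       _   = refl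
  run-occ (b ∷ v)     (suc q) occ = run-occ v q occ
  run-occ (true ∷ v)  zero    _   = refl

  run-empty : ∀ {n} (v : Vec Bool n) q → occAt v q ≡ false → run v q ≡ suc (run v (suc q))
  run-empty (b ∷ v)     (suc q) empty = run-empty v q empty
  run-empty (false ∷ v) zero    _     = refl

  EmptyOn-head : ∀ {n L} (v : Vec Bool n) a → EmptyOn v a (suc L) → occAt v a ≡ false
  EmptyOn-head v a empty = trans (cong (occAt v) (sym (+-identityʳ a))) (empty 0 (s≤s z≤n))

  EmptyOn-tail : ∀ {n L} (v : Vec Bool n) a → EmptyOn v a (suc L) → EmptyOn v (suc a) L
  EmptyOn-tail v a empty t t<L = trans (cong (occAt v) (sym (+-suc a t))) (empty (suc t) (s≤s t<L))

  run-unique : ∀ {n} (v : Vec Bool n) q R → EmptyOn v q R → occAt v (q +ℕ R) ≡ true → run v q ≡ R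
  run-unique v q zero    _     end = run-occ v q (trans (cong (occAt v) (sym (+-identityʳ q))) end)
  run-unique v q (suc R) empty end = trans (run-empty v q (EmptyOn-head v q empty))
    (cong suc (run-unique v (suc q) R (EmptyOn-tail v q empty) (trans (cong (occAt v) (sym (+-suc q R))) end)))

  run-≤ : ∀ {n} (v : Vec Bool n) q d → occAt v (q +ℕ d) ≡ true → run v q ≤ d
  run-≤ v q d occ with d <? run v q
  ... | yes d<run = ⊥-elim (true≢false (trans (sym occ) (run-emptyOn v q d d<run)))
  ... | no d≮run = ≮⇒≥ d≮run

  run-cong : ∀ {n} (v w : Vec Bool n) q → (∀ t → t ≤ run v q → occAt w (q +ℕ t) ≡ occAt v (q +ℕ t)) → run w q ≡ run v q
  run-cong v w q agree = run-unique w q (run v q)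
    (λ t t<run → trans (agree t (<⇒≤ t<run)) (run-emptyOn v q t t<run))
    (trans (agree (run v q) ≤-refl) (run-end v q))

  run≡2 : ∀ {n} (v : Vec Bool n) q → occAt v q ≡ false → occAt v (suc q) ≡ false → occAt v (suc (suc q)) ≡ true →
    run v q ≡ 2
  run≡2 v q empty₀ empty₁ occ₂ =
    trans (run-empty v q empty₀) (cong suc (trans (run-empty v (suc q) empty₁) (cong suc (run-occ v (suc (suc q)) occ₂))))

  run-shift : ∀ {n} (v : Vec Bool n) L a → EmptyOn v a L → run v a ≡ L +ℕ run v (a +ℕ L)
  run-shift v zero    a _     = cong (run v) (sym (+-identityʳ a))
  run-shift v (suc L) a empty = begin
    run v a                         ≡⟨ run-empty v a (EmptyOn-head v a empty) ⟩
    suc (run v (suc a))             ≡⟨ cong suc (run-shift v L (suc a) (EmptyOn-tail v a empty)) ⟩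
    suc (L +ℕ run v (suc a +ℕ L))   ≡⟨ cong (λ z → suc (L +ℕ run v z)) (+-suc a L) ⟨
    suc L +ℕ run v (a +ℕ suc L)     ∎
    where open ≡-Reasoning

  run-below : ∀ {n} (v : Vec Bool n) q p → q ≤ p → occAt v p ≡ true → q +ℕ run v q ≤ p
  run-below v q p q≤p occ = subst (q +ℕ run v q ≤_) (m+[n∸m]≡n q≤p)
    (+-monoʳ-≤ q (run-≤ v q (p ∸ q) (trans (cong (occAt v) (m+[n∸m]≡n q≤p)) occ)))

  run-before-leftOcc : ∀ {n} (v : Vec Bool n) q a → q < a → leftOcc v a ≡ true → q +ℕ run v q < a
  run-before-leftOcc v q (suc p) (s≤s q≤p) occ = s≤s (run-below v q p q≤p occ)

  runBefore : ∀ {n} → Vec Bool n → ℕ → ℕ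
  runBefore v zero    = 0
  runBefore v (suc q) = if occAt v q then 0 else suc (runBefore v q)

  runBefore-leftOcc : ∀ {n} (v : Vec Bool n) q → leftOcc v q ≡ true → runBefore v q ≡ 0
  runBefore-leftOcc v zero    _   = refl
  runBefore-leftOcc v (suc q) occ rewrite occ = refl

  runBefore≡2 : ∀ {n} (v : Vec Bool n) q → occAt v (suc q) ≡ false → occAt v q ≡ false → leftOcc v q ≡ true →
    runBefore v (suc (suc q)) ≡ 2
  runBefore≡2 v q empty₁ empty₀ left rewrite empty₁ | empty₀ | runBefore-leftOcc v q left = refl

  RunStart : ∀ {n} → Vec Bool n → ℕ → ℕ → Set
  RunStart v x a = (a +ℕ runBefore v x ≡ x) × (leftOcc v a ≡ true) × EmptyOn v a (runBefore v x)

  runStart : ∀ {n} (v : Vec Bool n) x → Σ ℕ (RunStart v x)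
  runStart v zero = 0 , refl , refl , λ t ()
  runStart v (suc p) with occAt v p in occ-p
  ... | true  = suc p , cong suc (+-identityʳ p) , occ-p , λ t ()
  ... | false with runStart v p
  ... | a , a+L≡p , left , empty = a , trans (+-suc a (runBefore v p)) (cong suc a+L≡p) , left , empty′
    where
    empty′ : EmptyOn v a (suc (runBefore v p))
    empty′ t (s≤s t≤L) with t ≟ℕ runBefore v p
    ... | yes refl = trans (cong (occAt v) a+L≡p) occ-p
    ... | no t≢L   = empty t (≤∧≢⇒< t≤L t≢L)

  rowValue : ℕ → Bool → Bool → ℚ
  rowValue k true  true  = outer k
  rowValue k true  false = asym k
  rowValue k false true  = asym k
  rowValue k false false = inner k

  rowValue-0 : ∀ l r → rowValue 0 l r ≡ 0ℚ
  rowValue-0 true  true  = refl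
  rowValue-0 true  false = refl
  rowValue-0 false true  = refl
  rowValue-0 false false = refl

  startsRun : ∀ {n} → Vec Bool n → ℕ → Bool
  startsRun v q = not (occAt v q) ∧ leftOcc v q

  runValue : ∀ {n} → State n → ℕ → ℚ
  runValue (st o k) q =
    if startsRun o q then rowValue (run o q) (napAt k q) (napAt k (q +ℕ run o q)) else 0ℚ

  sum< : ℕ → (ℕ → ℚ) → ℚ
  sum< zero    h = 0ℚ
  sum< (suc n) h = sum< n h + h n

  potential : ∀ {n} → State n → ℚ
  potential {n} s = sum< n (runValue s)

  runValue-start : ∀ {n} (o : Vec Bool n) k q → occAt o q ≡ false → leftOcc o q ≡ true →
    runValue (st o k) q ≡ rowValue (run o q) (napAt k q) (napAt k (q +ℕ run o q))
  runValue-start o k q empty left rewrite empty | left = refl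

  runValue-occ : ∀ {n} (o : Vec Bool n) k q → occAt o q ≡ true → runValue (st o k) q ≡ 0ℚ
  runValue-occ o k q occ rewrite occ = refl

  runValue-inside : ∀ {n} (o : Vec Bool n) k q → leftOcc o q ≡ false → runValue (st o k) q ≡ 0ℚ
  runValue-inside o k q left with occAt o q
  ... | true  = refl
  ... | false rewrite left = refl

  sum<-zero : ∀ n h → (∀ q → h q ≡ 0ℚ) → sum< n h ≡ 0ℚ
  sum<-zero zero    h zero-h = refl
  sum<-zero (suc n) h zero-h rewrite sum<-zero n h zero-h | zero-h n = refl

  sum<-cong-except-beyond : ∀ n h h′ a → n ≤ a → (∀ q → q ≢ a → h′ q ≡ h q) → sum< n h′ ≡ sum< n h
  sum<-cong-except-beyond zero    h h′ a n≤a agree = refl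
  sum<-cong-except-beyond (suc n) h h′ a n<a agree =
    cong₂ _+_ (sum<-cong-except-beyond n h h′ a (<⇒≤ n<a) agree) (agree n (<⇒≢ n<a))

  sum<-change₁ : ∀ n h h′ a → a < n → (∀ q → q ≢ a → h′ q ≡ h q) → sum< n h′ ≡ sum< n h + (h′ a - h a)
  sum<-change₁ (suc n) h h′ a a<1+n agree with n ≟ℕ a
  ... | yes refl = trans (cong (_+ h′ n) (sum<-cong-except-beyond n h h′ n ≤-refl agree))
    (solve 3 (λ S x y → S :+ y := S :+ x :+ (y :- x)) refl (sum< n h) (h n) (h′ n))
  ... | no n≢a = trans (cong₂ _+_ (sum<-change₁ n h h′ a (≤∧≢⇒< (≤-pred a<1+n) (n≢a ∘ sym)) agree) (agree n n≢a))
    (solve 4 (λ S x y z → S :+ (y :- x) :+ z := S :+ z :+ (y :- x)) refl (sum< n h) (h a) (h′ a) (h n))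

  sum<-single : ∀ n h a → a < n → (∀ q → q ≢ a → h q ≡ 0ℚ) → sum< n h ≡ h a
  sum<-single n h a a<n zero-elsewhere = begin
    sum< n h                              ≡⟨ sum<-change₁ n (λ _ → 0ℚ) h a a<n zero-elsewhere ⟩
    sum< n (λ _ → 0ℚ) + (h a - 0ℚ)        ≡⟨ cong (_+ (h a - 0ℚ)) (sum<-zero n (λ _ → 0ℚ) (λ _ → refl)) ⟩
    0ℚ + (h a - 0ℚ)                       ≡⟨ solve 1 (λ y → con 0ℚ :+ (y :- con 0ℚ) := y) refl (h a) ⟩
    h a                                   ∎
    where open ≡-Reasoning

  override : ℕ → (ℕ → ℚ) → (ℕ → ℚ) → ℕ → ℚ
  override a h h′ q with q ≟ℕ a
  ... | yes _ = h′ q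
  ... | no _  = h q

  override-at : ∀ a h h′ → override a h h′ a ≡ h′ a
  override-at a h h′ with a ≟ℕ a
  ... | yes _   = refl
  ... | no a≢a = ⊥-elim (a≢a refl)

  override-other : ∀ a h h′ q → q ≢ a → override a h h′ q ≡ h q
  override-other a h h′ q q≢a with q ≟ℕ a
  ... | yes q≡a = ⊥-elim (q≢a q≡a)
  ... | no _    = refl

  sum<-change₂ : ∀ n h h′ a b → a ≢ b → a < n → (n ≤ b → h′ b ≡ h b) → (∀ q → q ≢ a → q ≢ b → h′ q ≡ h q) →
    sum< n h′ ≡ sum< n h + (h′ a - h a) + (h′ b - h b)
  sum<-change₂ n h h′ a b a≢b a<n beyond agree with b <? n
  ... | yes b<n = begin
    sum< n h′                                   ≡⟨ sum<-change₁ n h″ h′ b b<n (λ q q≢b → agree″ q q≢b (q ≟ℕ a)) ⟩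
    sum< n h″ + (h′ b - h″ b)                   ≡⟨ cong₂ (λ x y → x + (h′ b - y)) first (override-other a h h′ b (a≢b ∘ sym)) ⟩
    sum< n h + (h′ a - h a) + (h′ b - h b)      ∎
    where
    open ≡-Reasoning
    h″ : ℕ → ℚ
    h″ = override a h h′
    first : sum< n h″ ≡ sum< n h + (h′ a - h a)
    first = trans (sum<-change₁ n h h″ a a<n (override-other a h h′)) (cong (λ t → sum< n h + (t - h a)) (override-at a h h′))
    agree″ : ∀ q → q ≢ b → Dec (q ≡ a) → h′ q ≡ h″ q
    agree″ q _   (yes refl) = sym (override-at q h h′)
    agree″ q q≢b (no q≢a)   = trans (agree q q≢a q≢b) (sym (override-other a h h′ q q≢a))
  ... | no b≮n = begin
    sum< n h′                                   ≡⟨ sum<-change₁ n h h′ a a<n (λ q q≢a → agree′ q q≢a (q ≟ℕ b)) ⟩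
    sum< n h + (h′ a - h a)                     ≡⟨ +ℚ-identityʳ _ ⟨
    sum< n h + (h′ a - h a) + 0ℚ                ≡⟨ cong (sum< n h + (h′ a - h a) +_) (trans (sym (+-inverseʳ (h b))) (cong (_- h b) (sym (beyond (≮⇒≥ b≮n))))) ⟩
    sum< n h + (h′ a - h a) + (h′ b - h b)      ∎
    where
    open ≡-Reasoning
    agree′ : ∀ q → q ≢ a → Dec (q ≡ b) → h′ q ≡ h q
    agree′ q _   (yes refl) = beyond (≮⇒≥ b≮n)
    agree′ q q≢a (no q≢b)   = agree q q≢a q≢b

  runValue-cong : ∀ {n} (o o′ : Vec Bool n) k k′ q → occAt o′ q ≡ occAt o q → leftOcc o′ q ≡ leftOcc o q →
    run o′ q ≡ run o q → napAt k′ q ≡ napAt k q → napAt k′ (q +ℕ run o q) ≡ napAt k (q +ℕ run o q) →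
    runValue (st o′ k′) q ≡ runValue (st o k) q
  runValue-cong o o′ k k′ q e₁ e₂ e₃ e₄ e₅ rewrite e₁ | e₂ | e₃ | e₄ | e₅ = refl

  -- Seating a diner at seat x of the run starting at a splits it into runs of lengths L and R;
  -- only the napkins x and x + 1 next to the diner may change.
  module Occupy {n} (o : Vec Bool n) (k k′ : Vec Bool (suc n)) (X : Fin n)
    (empty-x : occAt o (toℕ X) ≡ false)
    (napkins-agree : ∀ q → q ≢ toℕ X → q ≢ suc (toℕ X) → napAt k′ q ≡ napAt k q)
    (a : ℕ) (start : RunStart o (toℕ X) a) where

    x L R : ℕ
    x = toℕ X
    L = runBefore o x
    R = run o (suc x)

    a+L≡x : a +ℕ L ≡ x
    a+L≡x = proj₁ start

    left-a : leftOcc o a ≡ true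
    left-a = proj₁ (proj₂ start)

    empty-left : EmptyOn o a L
    empty-left = proj₂ (proj₂ start)

    o′ : Vec Bool n
    o′ = o [ X ]≔ true

    l r : Bool
    l = napAt k a
    r = napAt k (suc (x +ℕ R))

    occ′-x : occAt o′ x ≡ true
    occ′-x = at-[]≔ true o X true

    occ′-other : ∀ q → q ≢ x → occAt o′ q ≡ occAt o q
    occ′-other q q≢x = at-[]≔-other true o X true q q≢x

    leftOcc′-other : ∀ q → q ≢ suc x → leftOcc o′ q ≡ leftOcc o q
    leftOcc′-other zero    _      = refl
    leftOcc′-other (suc p) sp≢sx = occ′-other p (sp≢sx ∘ cong suc)

    a≤x : a ≤ x
    a≤x = subst (a ≤_) a+L≡x (m≤m+n a L)

    empty-between : ∀ p → a ≤ p → p < x → occAt o p ≡ false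
    empty-between p a≤p p<x = subst (λ z → occAt o z ≡ false) (m+[n∸m]≡n a≤p)
      (empty-left (p ∸ a) (+-cancelˡ-< a _ _ (subst₂ _<_ (sym (m+[n∸m]≡n a≤p)) (sym a+L≡x) p<x)))

    run-a : run o a ≡ L +ℕ suc R
    run-a = trans (run-shift o L a empty-left)
      (cong (L +ℕ_) (trans (cong (run o) a+L≡x) (run-empty o x empty-x)))

    a+run-a : a +ℕ (L +ℕ suc R) ≡ suc (x +ℕ R)
    a+run-a = trans (sym (+-assoc a L (suc R))) (trans (cong (_+ℕ suc R) a+L≡x) (+-suc x R))

    a≡x⊎a<x : (a ≡ x × L ≡ 0) ⊎ a < x
    a≡x⊎a<x with 0 <? L
    ... | yes L>0 = inj₂ (subst (a <_) a+L≡x (m<m+n a L>0))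
    ... | no  L≯0 = inj₁ (trans (sym (+-identityʳ a)) (trans (cong (a +ℕ_) (sym L≡0)) a+L≡x) , L≡0)
      where
      L≡0 : L ≡ 0
      L≡0 = n≤0⇒n≡0 (≮⇒≥ L≯0)

    empty-a : occAt o a ≡ false
    empty-a with a≡x⊎a<x
    ... | inj₁ (refl , _) = empty-x
    ... | inj₂ a<x        = empty-between a ≤-refl a<x

    value-a : runValue (st o k) a ≡ rowValue (L +ℕ suc R) l r
    value-a = trans (runValue-start o k a empty-a left-a)
      (cong₂ (λ len t → rowValue len l t) run-a (cong (napAt k) (trans (cong (a +ℕ_) run-a) a+run-a)))

    value′-a : runValue (st o′ k′) a ≡ rowValue L l (napAt k′ x)
    value′-a with a≡x⊎a<x
    ... | inj₁ (refl , L≡0) = trans (runValue-occ o′ k′ a occ′-x) (sym (trans (cong (λ z → rowValue z l (napAt k′ x)) L≡0) (rowValue-0 l _)))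
    ... | inj₂ a<x = begin
      runValue (st o′ k′) a                                   ≡⟨ runValue-start o′ k′ a (trans (occ′-other a (<⇒≢ a<x)) empty-a)
                                                                   (trans (leftOcc′-other a (<⇒≢ (≤-trans a<x (n≤1+n x)))) left-a) ⟩
      rowValue (run o′ a) (napAt k′ a) (napAt k′ (a +ℕ run o′ a)) ≡⟨ cong (λ len → rowValue len (napAt k′ a) (napAt k′ (a +ℕ len))) run′-a ⟩
      rowValue L (napAt k′ a) (napAt k′ (a +ℕ L))              ≡⟨ cong₂ (rowValue L) (napkins-agree a (<⇒≢ a<x) (<⇒≢ (≤-trans a<x (n≤1+n x))))
                                                                   (cong (napAt k′) a+L≡x) ⟩
      rowValue L l (napAt k′ x)                               ∎
      where
      open ≡-Reasoning
      run′-a : run o′ a ≡ L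
      run′-a = run-unique o′ a L
        (λ t t<L → trans (occ′-other (a +ℕ t) (<⇒≢ (subst (a +ℕ t <_) a+L≡x (+-monoʳ-< a t<L)))) (empty-left t t<L))
        (trans (cong (occAt o′) a+L≡x) occ′-x)

    value-after-x : runValue (st o k) (suc x) ≡ 0ℚ
    value-after-x = runValue-inside o k (suc x) empty-x

    value′-after-x : runValue (st o′ k′) (suc x) ≡ rowValue R (napAt k′ (suc x)) r
    value′-after-x with occAt o (suc x) in occ-sx
    ... | true = begin
      runValue (st o′ k′) (suc x)         ≡⟨ runValue-occ o′ k′ (suc x) (trans (occ′-other (suc x) (>⇒≢ (n<1+n x))) occ-sx) ⟩
      0ℚ                                  ≡⟨ rowValue-0 (napAt k′ (suc x)) r ⟨
      rowValue 0 (napAt k′ (suc x)) r     ≡⟨ cong (λ z → rowValue z (napAt k′ (suc x)) r) (run-occ o (suc x) occ-sx) ⟨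
      rowValue R (napAt k′ (suc x)) r     ∎
      where open ≡-Reasoning
    ... | false = begin
      runValue (st o′ k′) (suc x)          ≡⟨ runValue-start o′ k′ (suc x) (trans (occ′-other (suc x) (>⇒≢ (n<1+n x))) occ-sx) occ′-x ⟩
      rowValue (run o′ (suc x)) (napAt k′ (suc x)) (napAt k′ (suc x +ℕ run o′ (suc x)))
                                           ≡⟨ cong (λ len → rowValue len (napAt k′ (suc x)) (napAt k′ (suc x +ℕ len))) run′-sx ⟩
      rowValue R (napAt k′ (suc x)) (napAt k′ (suc x +ℕ R))
                                           ≡⟨ cong (rowValue R (napAt k′ (suc x))) (napkins-agree (suc x +ℕ R) (>⇒≢ (m≤m+n (suc x) R)) (>⇒≢ (m<m+n (suc x) R>0))) ⟩
      rowValue R (napAt k′ (suc x)) r      ∎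
      where
      open ≡-Reasoning
      run′-sx : run o′ (suc x) ≡ R
      run′-sx = run-cong o o′ (suc x) (λ t _ → occ′-other (suc x +ℕ t) (>⇒≢ (s≤s (m≤m+n x t))))
      R>0 : 0 < R
      R>0 = subst (0 <_) (sym (run-empty o (suc x) occ-sx)) (s≤s z≤n)

    value-before : ∀ q → q < a → runValue (st o′ k′) q ≡ runValue (st o k) q
    value-before q q<a = runValue-cong o o′ k k′ q (occ′-other q (<⇒≢ q<x)) (leftOcc′-other q (<⇒≢ (≤-trans q<x (n≤1+n x))))
      (run-cong o o′ q (λ t t≤run → occ′-other (q +ℕ t) (<⇒≢ (≤-<-trans (+-monoʳ-≤ q t≤run) end<x))))
      (napkins-agree q (<⇒≢ q<x) (<⇒≢ (≤-trans q<x (n≤1+n x))))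
      (napkins-agree (q +ℕ run o q) (<⇒≢ end<x) (<⇒≢ (≤-trans end<x (n≤1+n x))))
      where
      q<x : q < x
      q<x = ≤-trans q<a a≤x
      end<x : q +ℕ run o q < x
      end<x = <-≤-trans (run-before-leftOcc o q a q<a left-a) a≤x

    value-within : ∀ q → a < q → q ≤ x → runValue (st o′ k′) q ≡ runValue (st o k) q
    value-within (suc p) a<sp sp≤x = trans value′ (sym (runValue-inside o k (suc p) empty-p))
      where
      empty-p : occAt o p ≡ false
      empty-p = empty-between p (≤-pred a<sp) sp≤x
      value′ : runValue (st o′ k′) (suc p) ≡ 0ℚ
      value′ with suc p ≟ℕ x
      ... | yes sp≡x = runValue-occ o′ k′ (suc p) (trans (cong (occAt o′) sp≡x) occ′-x)
      ... | no  _    = runValue-inside o′ k′ (suc p) (trans (occ′-other p (<⇒≢ sp≤x)) empty-p)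

    value-beyond : ∀ q → suc x < q → runValue (st o′ k′) q ≡ runValue (st o k) q
    value-beyond q sx<q = runValue-cong o o′ k k′ q (occ′-other q (>⇒≢ x<q)) (leftOcc′-other q (>⇒≢ sx<q))
      (run-cong o o′ q (λ t _ → occ′-other (q +ℕ t) (>⇒≢ (≤-trans x<q (m≤m+n q t)))))
      (napkins-agree q (>⇒≢ x<q) (>⇒≢ sx<q))
      (napkins-agree (q +ℕ run o q) (>⇒≢ (≤-trans x<q (m≤m+n q _))) (>⇒≢ (≤-trans sx<q (m≤m+n q _))))
      where
      x<q : x < q
      x<q = ≤-trans (n≤1+n _) sx<q

    value-other : ∀ q → q ≢ a → q ≢ suc x → runValue (st o′ k′) q ≡ runValue (st o k) q
    value-other q q≢a q≢sx with <-cmp q a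
    ... | tri< q<a _ _ = value-before q q<a
    ... | tri≈ _ q≡a _ = ⊥-elim (q≢a q≡a)
    ... | tri> _ _ a<q with <-cmp q (suc x)
    ...   | tri< q<sx _ _  = value-within q a<q (≤-pred q<sx)
    ...   | tri≈ _ q≡sx _  = ⊥-elim (q≢sx q≡sx)
    ...   | tri> _ _ sx<q  = value-beyond q sx<q

    potential-occupy : potential (st o′ k′) ≡
      potential (st o k) + (rowValue L l (napAt k′ x) - rowValue (L +ℕ suc R) l r) + (rowValue R (napAt k′ (suc x)) r - 0ℚ)
    potential-occupy = trans
      (sum<-change₂ n (runValue (st o k)) (runValue (st o′ k′)) a (suc x) (<⇒≢ (s≤s a≤x)) (≤-<-trans a≤x (toℕ<n X))
        (λ n≤sx → trans (runValue-occ o′ k′ (suc x) (at-beyond true o′ (suc x) n≤sx))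
                        (sym (runValue-occ o k (suc x) (at-beyond true o (suc x) n≤sx))))
        value-other)
      (cong₂ (λ A B → potential (st o k) + A + B) (cong₂ _-_ value′-a value-a) (cong₂ _-_ value′-after-x value-after-x))

  -- The configurations in which strategy S may seat a diner: after the first L seats of a run
  -- of L + 1 + R empty seats whose boundary napkins are l and r.
  data Split : ℕ → ℕ → Bool → Bool → Set where
    S1ˡ   : ∀ R r → Split 0 R true r
    S1ʳ   : ∀ L l → Split L 0 l true
    S2ˡ   : ∀ R → Split 2 R false false
    S2ʳ   : ∀ L → Split L 2 false false
    lone  : Split 0 0 false false
    pairˡ : Split 1 0 false false
    pairʳ : Split 0 1 false false

  adjacentNapkin : ℕ → Bool → Bool
  adjacentNapkin zero    boundary = boundary
  adjacentNapkin (suc _) _        = true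

  -- The first two arguments tell whether the napkins on the diner's left and right are available.
  afterSeating : Bool → Bool → ℕ → ℕ → Bool → Bool → ℚ
  afterSeating true  true  L R l r =
    ½ * (rowValue L l false + rowValue R true r) + ½ * (rowValue L l true + rowValue R false r)
  afterSeating true  false L R l r = rowValue L l false + rowValue R false r
  afterSeating false true  L R l r = rowValue L l false + rowValue R false r
  afterSeating false false L R l r = 1ℚ + (rowValue L l false + rowValue R false r)

  rowValue-split : ∀ {L R l r} → Split L R l r →
    rowValue (L +ℕ suc R) l r ≡ afterSeating (adjacentNapkin L l) (adjacentNapkin R r) L R l r
  rowValue-split (S1ˡ zero true)     = refl
  rowValue-split (S1ˡ zero false)    = refl
  rowValue-split (S1ˡ (suc R) true)  =
    solve 2 (λ o a → con ½ :* (o :+ a) := con ½ :* (con 0ℚ :+ o) :+ con ½ :* (con 0ℚ :+ a)) refl (outer (suc R)) (asym (suc R))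
  rowValue-split (S1ˡ (suc R) false) =
    solve 2 (λ a i → con ½ :* (a :+ i) := con ½ :* (con 0ℚ :+ a) :+ con ½ :* (con 0ℚ :+ i)) refl (asym (suc R)) (inner (suc R))
  rowValue-split (S1ʳ zero true)     = refl
  rowValue-split (S1ʳ zero false)    = refl
  rowValue-split (S1ʳ (suc L) true)  rewrite +-comm L 1 =
    solve 2 (λ o a → con ½ :* (o :+ a) := con ½ :* (a :+ con 0ℚ) :+ con ½ :* (o :+ con 0ℚ)) refl (outer (suc L)) (asym (suc L))
  rowValue-split (S1ʳ (suc L) false) rewrite +-comm L 1 =
    solve 2 (λ a i → con ½ :* (a :+ i) := con ½ :* (i :+ con 0ℚ) :+ con ½ :* (a :+ con 0ℚ)) refl (asym (suc L)) (inner (suc L))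
  rowValue-split (S2ˡ zero)          = refl
  rowValue-split (S2ˡ (suc R))       =
    solve 2 (λ a i → con ½ :* (con ³⁄₂ :+ a :+ i) := con ½ :* (con 1ℚ :+ a) :+ con ½ :* (con ½ :+ i)) refl (asym (suc R)) (inner (suc R))
  rowValue-split (S2ʳ zero)          = refl
  rowValue-split (S2ʳ (suc L))       rewrite +-comm L 3 =
    solve 2 (λ a i → con ½ :* (con ³⁄₂ :+ a :+ i) := con ½ :* (i :+ con ½) :+ con ½ :* (a :+ con 1ℚ)) refl (asym (suc L)) (inner (suc L))
  rowValue-split lone                = refl
  rowValue-split pairˡ               = refl
  rowValue-split pairʳ               = refl

  S1-split : ∀ {L R l r} → (L ≡ 0 × l ≡ true) ⊎ (R ≡ 0 × r ≡ true) → Split L R l r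
  S1-split (inj₁ (refl , refl)) = S1ˡ _ _
  S1-split (inj₂ (refl , refl)) = S1ʳ _ _

  S2-split : ∀ {L R} → L ≡ 2 ⊎ R ≡ 2 → Split L R false false
  S2-split (inj₁ refl) = S2ˡ _
  S2-split (inj₂ refl) = S2ʳ _

  strategy-split : ∀ {L R l r} →
    (l ≡ true ⊎ r ≡ true → (L ≡ 0 × l ≡ true) ⊎ (R ≡ 0 × r ≡ true)) →
    (l ≡ false → r ≡ false → 2 < L +ℕ suc R → L ≡ 2 ⊎ R ≡ 2) →
    Split L R l r
  strategy-split {l = true}                         s1 _  = S1-split (s1 (inj₁ refl))
  strategy-split {l = false} {true}                 s1 _  = S1-split (s1 (inj₂ refl))
  strategy-split {0}           {0}           {false} {false} _ _  = lone
  strategy-split {1}           {0}           {false} {false} _ _  = pairˡ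
  strategy-split {0}           {1}           {false} {false} _ _  = pairʳ
  strategy-split {suc (suc L)} {R}           {false} {false} _ s2 =
    S2-split (s2 refl refl (s≤s (s≤s (≤-trans (s≤s z≤n) (m≤n+m (suc R) L)))))
  strategy-split {1}           {suc R}       {false} {false} _ s2 = S2-split (s2 refl refl (s≤s (s≤s (s≤s z≤n))))
  strategy-split {0}           {suc (suc R)} {false} {false} _ s2 = S2-split (s2 refl refl (s≤s (s≤s (s≤s z≤n))))

  -- EmptyPos counts positions from the left flank: position suc q is seat q.
  module Positions {n} (s : State n) where

    ¬emptyPos-0 : ¬ EmptyPos s 0
    ¬emptyPos-0 (_ , () , _)

    seatAt : ∀ q → occAt (occ s) q ≡ false → Fin n
    seatAt q empty = fromℕ< (at≡not-default⇒< true (occ s) q empty)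

    toℕ-seatAt : ∀ q empty → toℕ (seatAt q empty) ≡ q
    toℕ-seatAt q empty = toℕ-fromℕ< (at≡not-default⇒< true (occ s) q empty)

    seatAt-empty : ∀ q empty → EmptySeat s (seatAt q empty)
    seatAt-empty q empty = trans (lookup≡at true (occ s) (seatAt q empty)) (trans (cong (occAt (occ s)) (toℕ-seatAt q empty)) empty)

    emptyPos⇒empty : ∀ p q → p ≡ suc q → EmptyPos s p → occAt (occ s) q ≡ false
    emptyPos⇒empty p q p≡sq (i , si≡p , empty-i) =
      trans (cong (occAt (occ s)) (suc-injective (sym (trans si≡p p≡sq)))) (trans (sym (lookup≡at true (occ s) i)) empty-i)

    empty⇒emptyPos : ∀ p q → p ≡ suc q → occAt (occ s) q ≡ false → EmptyPos s p
    empty⇒emptyPos p q p≡sq empty = seatAt q empty , trans (cong suc (toℕ-seatAt q empty)) (sym p≡sq) , seatAt-empty q empty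

    ¬emptyPos⇒occ : ∀ p q → p ≡ suc q → ¬ EmptyPos s p → occAt (occ s) q ≡ true
    ¬emptyPos⇒occ p q p≡sq ¬empty with occAt (occ s) q in occ-q
    ... | true  = refl
    ... | false = ⊥-elim (¬empty (empty⇒emptyPos p q p≡sq occ-q))

    occ⇒¬emptyPos : ∀ p q → p ≡ suc q → occAt (occ s) q ≡ true → ¬ EmptyPos s p
    occ⇒¬emptyPos p q p≡sq occ empty = true≢false (trans (sym occ) (emptyPos⇒empty p q p≡sq empty))

    leftOcc⇒¬emptyPos : ∀ a → leftOcc (occ s) a ≡ true → ¬ EmptyPos s a
    leftOcc⇒¬emptyPos zero    _   = ¬emptyPos-0
    leftOcc⇒¬emptyPos (suc p) occ = occ⇒¬emptyPos (suc p) p refl occ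

    ¬emptyPos⇒leftOcc : ∀ a → ¬ EmptyPos s a → leftOcc (occ s) a ≡ true
    ¬emptyPos⇒leftOcc zero    _      = refl
    ¬emptyPos⇒leftOcc (suc p) ¬empty = ¬emptyPos⇒occ (suc p) p refl ¬empty

  module Choice (c : Chooser) (follows : FollowsS c) {n} (o : Vec Bool n) (k : Vec Bool (suc n)) (X : Fin n)
    (chosen : c (st o k) ≡ just X) (empty-x : occAt o (toℕ X) ≡ false) where
    open FollowsS follows
    open Positions (st o k)

    s : State n
    s = st o k

    a : ℕ
    a = proj₁ (runStart o (toℕ X))

    start : RunStart o (toℕ X) a
    start = proj₂ (runStart o (toℕ X))

    open Occupy o k k X empty-x (λ _ _ _ → refl) a start using (x; L; R; l; r; a+L≡x; left-a; run-a; empty-a)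

    napAt-left : napAt k x ≡ lookup k (inject₁ X)
    napAt-left = trans (cong (napAt k) (sym (toℕ-inject₁ X))) (sym (lookup≡at false k (inject₁ X)))

    napAt-right : napAt k (suc x) ≡ lookup k (fsuc X)
    napAt-right = sym (lookup≡at false k (fsuc X))

    empty-run : EmptyOn o a (L +ℕ suc R)
    empty-run = subst (EmptyOn o a) run-a (run-emptyOn o a)

    chosen-S1 : S1Seat s X → (L ≡ 0 × l ≡ true) ⊎ (R ≡ 0 × r ≡ true)
    chosen-S1 (_ , inj₁ (left-free , ¬empty)) = inj₁ (L≡0 , trans (cong (napAt k) a≡x) (trans napAt-left left-free))
      where
      L≡0 : L ≡ 0
      L≡0 = runBefore-leftOcc o x (¬emptyPos⇒leftOcc x ¬empty)
      a≡x : a ≡ x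
      a≡x = trans (sym (+-identityʳ a)) (trans (cong (a +ℕ_) (sym L≡0)) a+L≡x)
    chosen-S1 (_ , inj₂ (right-free , ¬empty)) = inj₂ (R≡0 , trans (cong (λ z → napAt k (suc z)) x+R≡x) (trans napAt-right right-free))
      where
      R≡0 : R ≡ 0
      R≡0 = run-occ o (suc x) (¬emptyPos⇒occ (x +ℕ 2) (suc x) (+-comm x 2) ¬empty)
      x+R≡x : x +ℕ R ≡ x
      x+R≡x = trans (cong (x +ℕ_) R≡0) (+-identityʳ x)

    chosen-S2 : S2Seat s X → L ≡ 2 ⊎ R ≡ 2
    chosen-S2 (_ , inj₁ (empty₁ , empty₂ , ¬empty₃)) = inj₂ (run≡2 o (suc x)
      (emptyPos⇒empty _ _ (cong suc (+-comm x 1)) empty₁)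
      (emptyPos⇒empty _ _ (cong suc (+-comm x 2)) empty₂)
      (¬emptyPos⇒occ _ _ (cong suc (+-comm x 3)) ¬empty₃))
    chosen-S2 (_ , inj₂ (empty₁ , empty₂ , ¬empty₃)) = inj₁ (runBefore-pair x empty₁ empty₂ ¬empty₃)
      where
      runBefore-pair : ∀ y → EmptyPos s (suc y ∸ 1) → EmptyPos s (suc y ∸ 2) → ¬ EmptyPos s (suc y ∸ 3) → runBefore o y ≡ 2
      runBefore-pair 0             e₁ _  _   = ⊥-elim (¬emptyPos-0 e₁)
      runBefore-pair 1             _  e₂ _   = ⊥-elim (¬emptyPos-0 e₂)
      runBefore-pair (suc (suc q)) e₁ e₂ ¬e₃ =
        runBefore≡2 o q (emptyPos⇒empty _ _ refl e₁) (emptyPos⇒empty _ _ refl e₂) (¬emptyPos⇒leftOcc q ¬e₃)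

    S1-witness : l ≡ true ⊎ r ≡ true → S1Applies s
    S1-witness (inj₁ l-free) = Xa , seatAt-empty a empty-a ,
      inj₁ (trans (lookup≡at false k (inject₁ Xa)) (trans (cong (napAt k) (trans (toℕ-inject₁ Xa) (toℕ-seatAt a empty-a))) l-free) ,
            subst (λ z → ¬ EmptyPos s z) (sym (toℕ-seatAt a empty-a)) (leftOcc⇒¬emptyPos a left-a))
      where
      Xa : Fin n
      Xa = seatAt a empty-a
    S1-witness (inj₂ r-free) = Xr , seatAt-empty (x +ℕ R) empty-end ,
      inj₂ (trans (lookup≡at false k (fsuc Xr)) (trans (cong (λ z → napAt k (suc z)) toℕ-Xr) r-free) ,
            occ⇒¬emptyPos (toℕ Xr +ℕ 2) (suc (x +ℕ R)) (trans (+-comm (toℕ Xr) 2) (cong (suc ∘ suc) toℕ-Xr)) (run-end o (suc x)))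
      where
      empty-end : occAt o (x +ℕ R) ≡ false
      empty-end = subst (λ z → occAt o z ≡ false) (trans (sym (+-assoc a L R)) (cong (_+ℕ R) a+L≡x))
        (empty-run (L +ℕ R) (subst (L +ℕ R <_) (sym (+-suc L R)) (n<1+n (L +ℕ R))))
      Xr : Fin n
      Xr = seatAt (x +ℕ R) empty-end
      toℕ-Xr : toℕ Xr ≡ x +ℕ R
      toℕ-Xr = toℕ-seatAt (x +ℕ R) empty-end

    ¬S1 : l ≡ false → r ≡ false → ¬ S1Applies s
    ¬S1 l-taken r-taken applies with chosen-S1 (rule-S1 s X applies chosen)
    ... | inj₁ (_ , l-free) = true≢false (trans (sym l-free) l-taken)
    ... | inj₂ (_ , r-free) = true≢false (trans (sym r-free) r-taken)

    S2-witness : 2 < L +ℕ suc R → S2Applies s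
    S2-witness 2<len = Xw , seatAt-empty (a +ℕ 2) empty₂ , inj₂
      ( empty⇒emptyPos (toℕ Xw) (a +ℕ 1) (trans toℕ-Xw (cong suc (+-comm 1 a))) (empty-run 1 (≤-trans (n≤1+n 2) 2<len))
      , empty⇒emptyPos (toℕ Xw ∸ 1) a (cong (_∸ 1) toℕ-Xw) empty-a
      , subst (λ z → ¬ EmptyPos s z) (sym (cong (_∸ 2) toℕ-Xw)) (leftOcc⇒¬emptyPos a left-a))
      where
      empty₂ : occAt o (a +ℕ 2) ≡ false
      empty₂ = empty-run 2 2<len
      Xw : Fin n
      Xw = seatAt (a +ℕ 2) empty₂
      toℕ-Xw : toℕ Xw ≡ suc (suc a)
      toℕ-Xw = trans (toℕ-seatAt (a +ℕ 2) empty₂) (+-comm a 2)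

    split : Split L R l r
    split = strategy-split
      (λ free → chosen-S1 (rule-S1 s X (S1-witness free) chosen))
      (λ l-taken r-taken 2<len → chosen-S2 (rule-S2 s X (¬S1 l-taken r-taken) (S2-witness 2<len) chosen))

  InnerNapkinsAvailable : ∀ {n} → State n → Set
  InnerNapkinsAvailable (st o k) = ∀ q → occAt o q ≡ false → occAt o (suc q) ≡ false → napAt k (suc q) ≡ true

  emptyCount : ∀ {n} → Vec Bool n → ℕ
  emptyCount []          = 0
  emptyCount (true ∷ v)  = emptyCount v
  emptyCount (false ∷ v) = suc (emptyCount v)

  emptyCount-[]≔ : ∀ {n} (v : Vec Bool n) i → lookup v i ≡ false → emptyCount v ≡ suc (emptyCount (v [ i ]≔ true))
  emptyCount-[]≔ (false ∷ v) fzero    refl  = refl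
  emptyCount-[]≔ (true ∷ v)  (fsuc i) empty = emptyCount-[]≔ v i empty
  emptyCount-[]≔ (false ∷ v) (fsuc i) empty = cong suc (emptyCount-[]≔ v i empty)

  emptyCount≡0⇒full : ∀ {n} (v : Vec Bool n) → emptyCount v ≡ 0 → ∀ q → occAt v q ≡ true
  emptyCount≡0⇒full []         _    q       = refl
  emptyCount≡0⇒full (true ∷ v) _    zero    = refl
  emptyCount≡0⇒full (true ∷ v) none (suc q) = emptyCount≡0⇒full v none q

  firstEmpty : ∀ {n} (v : Vec Bool n) → (Σ (Fin n) λ i → lookup v i ≡ false) ⊎ (∀ q → occAt v q ≡ true)
  firstEmpty []          = inj₂ (λ q → refl)
  firstEmpty (false ∷ v) = inj₁ (fzero , refl)
  firstEmpty (true ∷ v)  with firstEmpty v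
  ... | inj₁ (i , empty) = inj₁ (fsuc i , empty)
  ... | inj₂ full        = inj₂ λ { zero → refl ; (suc q) → full q }

  potential-full : ∀ {n} (s : State n) → (∀ q → occAt (occ s) q ≡ true) → potential s ≡ 0ℚ
  potential-full {n} (st o k) full = sum<-zero n (runValue (st o k)) (λ q → runValue-occ o k q (full q))

  split-balance₂ : ∀ V w a b c d → w ≡ ½ * (a + b) + ½ * (c + d) →
    ½ * (V + (a - w) + (b - 0ℚ)) + ½ * (V + (c - w) + (d - 0ℚ)) ≡ V
  split-balance₂ V w a b c d refl = solve 5 (λ V a b c d →
      con ½ :* (V :+ (a :- (con ½ :* (a :+ b) :+ con ½ :* (c :+ d))) :+ (b :- con 0ℚ))
        :+ con ½ :* (V :+ (c :- (con ½ :* (a :+ b) :+ con ½ :* (c :+ d))) :+ (d :- con 0ℚ)) := V) refl V a b c d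

  split-balance₁ : ∀ V w a b → w ≡ a + b → V + (a - w) + (b - 0ℚ) ≡ V
  split-balance₁ V w a b refl = solve 3 (λ V a b → V :+ (a :- (a :+ b)) :+ (b :- con 0ℚ) := V) refl V a b

  split-balance₀ : ∀ V w a b → w ≡ 1ℚ + (a + b) → 1ℚ + (V + (a - w) + (b - 0ℚ)) ≡ V
  split-balance₀ V w a b refl = solve 3 (λ V a b → con 1ℚ :+ (V :+ (a :- (con 1ℚ :+ (a :+ b))) :+ (b :- con 0ℚ)) := V) refl V a b

  module ValueTheorem (c : Chooser) (follows : FollowsS c) where
    open FollowsS follows

    expNapkinless-full : ∀ f {n} (o : Vec Bool n) k → (∀ q → occAt o q ≡ true) → expNapkinless c (suc f) (st o k) ≡ 0ℚ
    expNapkinless-full f o k full with c (st o k)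
    ... | nothing = refl
    ... | just X with lookup o X in occ-X
    ...   | true  = refl
    ...   | false = ⊥-elim (true≢false (trans (sym (full (toℕ X))) (trans (sym (lookup≡at true o X)) occ-X)))

    module Step (f : ℕ) {n} (o : Vec Bool n) (k : Vec Bool (suc n)) (inner-free : InnerNapkinsAvailable (st o k)) (X : Fin n)
      (chosen : c (st o k) ≡ just X) (empty : lookup o X ≡ false)
      (ih : ∀ k′ → InnerNapkinsAvailable (st (o [ X ]≔ true) k′) →
            expNapkinless c f (st (o [ X ]≔ true) k′) ≡ potential (st (o [ X ]≔ true) k′)) where

      empty-x : occAt o (toℕ X) ≡ false
      empty-x = trans (sym (lookup≡at true o X)) empty

      open Choice c follows o k X chosen empty-x
      open Occupy o k k X empty-x (λ _ _ _ → refl) a start using (x; L; R; l; r; a+L≡x; empty-left; o′; occ′-x)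

      NapkinsAgree : Vec Bool (suc n) → Set
      NapkinsAgree k′ = ∀ q → q ≢ x → q ≢ suc x → napAt k′ q ≡ napAt k q

      inner-free′ : ∀ k′ → NapkinsAgree k′ → InnerNapkinsAvailable (st o′ k′)
      inner-free′ k′ agree q empty₀ empty₁ =
        trans (agree (suc q) sq≢x (q≢x ∘ suc-injective))
          (inner-free q (trans (sym (at-[]≔-other true o X true q q≢x)) empty₀) (trans (sym (at-[]≔-other true o X true (suc q) sq≢x)) empty₁))
        where
        q≢x : q ≢ x
        q≢x q≡x = true≢false (trans (sym occ′-x) (trans (cong (occAt o′) (sym q≡x)) empty₀))
        sq≢x : suc q ≢ x
        sq≢x sq≡x = true≢false (trans (sym occ′-x) (trans (cong (occAt o′) (sym sq≡x)) empty₁))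

      whole : ℚ
      whole = rowValue (L +ℕ suc R) l r

      value-after : ∀ k′ → NapkinsAgree k′ → ∀ A B → napAt k′ x ≡ A → napAt k′ (suc x) ≡ B →
        expNapkinless c f (st o′ k′) ≡ potential (st o k) + (rowValue L l A - whole) + (rowValue R B r - 0ℚ)
      value-after k′ agree A B left right = trans (ih k′ (inner-free′ k′ agree))
        (trans (Occupy.potential-occupy o k k′ X empty-x agree a start)
          (cong₂ (λ A B → potential (st o k) + (rowValue L l A - whole) + (rowValue R B r - 0ℚ)) left right))

      adjacent-left : napAt k x ≡ adjacentNapkin L l
      adjacent-left = go L a+L≡x empty-left
        where
        go : ∀ L′ → a +ℕ L′ ≡ x → EmptyOn o a L′ → napAt k x ≡ adjacentNapkin L′ l
        go zero    a+0≡x _      = cong (napAt k) (sym (trans (sym (+-identityʳ a)) a+0≡x))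
        go (suc L′) a+L≡x′ empty′ = trans (cong (napAt k) (sym a+L′+1≡x))
          (inner-free (a +ℕ L′) (empty′ L′ (n<1+n L′)) (trans (cong (occAt o) a+L′+1≡x) empty-x))
          where
          a+L′+1≡x : suc (a +ℕ L′) ≡ x
          a+L′+1≡x = trans (sym (+-suc a L′)) a+L≡x′

      adjacent-right : napAt k (suc x) ≡ adjacentNapkin R r
      adjacent-right = go R refl
        where
        go : ∀ R′ → run o (suc x) ≡ R′ → napAt k (suc x) ≡ adjacentNapkin R′ (napAt k (suc (x +ℕ R′)))
        go zero     _     = cong (λ z → napAt k (suc z)) (sym (+-identityʳ x))
        go (suc R′) run≡ = inner-free x empty-x (EmptyOn-head o (suc x) (subst (EmptyOn o (suc x)) run≡ (run-emptyOn o (suc x))))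

      whole≡afterSeating : ∀ A B → napAt k x ≡ A → napAt k (suc x) ≡ B → whole ≡ afterSeating A B L R l r
      whole≡afterSeating A B left right =
        trans (rowValue-split split) (cong₂ (λ A B → afterSeating A B L R l r) (trans (sym adjacent-left) left) (trans (sym adjacent-right) right))

      takeLeft takeRight : Vec Bool (suc n)
      takeLeft  = k [ inject₁ X ]≔ false
      takeRight = k [ fsuc X ]≔ false

      takeLeft-agree : NapkinsAgree takeLeft
      takeLeft-agree q q≢x _ = at-[]≔-other false k (inject₁ X) false q (q≢x ∘ (λ q≡ → trans q≡ (toℕ-inject₁ X)))

      takeRight-agree : NapkinsAgree takeRight
      takeRight-agree q _ q≢sx = at-[]≔-other false k (fsuc X) false q q≢sx

      takeLeft-x : napAt takeLeft x ≡ false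
      takeLeft-x = trans (cong (napAt takeLeft) (sym (toℕ-inject₁ X))) (at-[]≔ false k (inject₁ X) false)

      takeLeft-sx : napAt takeLeft (suc x) ≡ napAt k (suc x)
      takeLeft-sx = at-[]≔-other false k (inject₁ X) false (suc x) (>⇒≢ (n<1+n x) ∘ (λ sx≡ → trans sx≡ (toℕ-inject₁ X)))

      takeRight-x : napAt takeRight x ≡ napAt k x
      takeRight-x = at-[]≔-other false k (fsuc X) false x (<⇒≢ (n<1+n x))

      takeRight-sx : napAt takeRight (suc x) ≡ false
      takeRight-sx = at-[]≔ false k (fsuc X) false

      expNapkinless-step : expNapkinless c (suc f) (st o k) ≡ potential (st o k)
      expNapkinless-step rewrite chosen | empty with lookup k (inject₁ X) in left | lookup k (fsuc X) in right
      ... | true  | true  = trans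
        (cong₂ (λ u v → ½ * u + ½ * v)
          (value-after takeLeft takeLeft-agree false true takeLeft-x (trans takeLeft-sx (trans napAt-right right)))
          (value-after takeRight takeRight-agree true false (trans takeRight-x (trans napAt-left left)) takeRight-sx))
        (split-balance₂ _ whole (rowValue L l false) (rowValue R true r) (rowValue L l true) (rowValue R false r)
          (whole≡afterSeating true true (trans napAt-left left) (trans napAt-right right)))
      ... | true  | false = trans
        (value-after takeLeft takeLeft-agree false false takeLeft-x (trans takeLeft-sx (trans napAt-right right)))
        (split-balance₁ _ whole (rowValue L l false) (rowValue R false r)
          (whole≡afterSeating true false (trans napAt-left left) (trans napAt-right right)))
      ... | false | true  = trans
        (value-after takeRight takeRight-agree false false (trans takeRight-x (trans napAt-left left)) takeRight-sx)
        (split-balance₁ _ whole (rowValue L l false) (rowValue R false r)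
          (whole≡afterSeating false true (trans napAt-left left) (trans napAt-right right)))
      ... | false | false = trans
        (cong (1ℚ +_) (value-after k (λ _ _ _ → refl) false false (trans napAt-left left) (trans napAt-right right)))
        (split-balance₀ _ whole (rowValue L l false) (rowValue R false r)
          (whole≡afterSeating false false (trans napAt-left left) (trans napAt-right right)))

    expNapkinless≡potential : ∀ f {n} (o : Vec Bool n) k → InnerNapkinsAvailable (st o k) → emptyCount o ≤ f →
      expNapkinless c f (st o k) ≡ potential (st o k)
    expNapkinless≡potential zero    o k _          count≤0 = sym (potential-full (st o k) (emptyCount≡0⇒full o (n≤0⇒n≡0 count≤0)))
    expNapkinless≡potential (suc f) o k inner-free count≤f with firstEmpty o
    ... | inj₂ full = trans (expNapkinless-full f o k full) (sym (potential-full (st o k) full))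
    ... | inj₁ some-empty with picks-empty (st o k) some-empty
    ... | X , chosen , empty = Step.expNapkinless-step f o k inner-free X chosen empty
      (λ k′ inner-free′ → expNapkinless≡potential f (o [ X ]≔ true) k′ inner-free′
        (≤-pred (subst (_≤ suc f) (emptyCount-[]≔ o X empty) count≤f)))

  run-replicate : ∀ n → run (replicate n false) 0 ≡ n
  run-replicate zero    = refl
  run-replicate (suc n) = cong suc (run-replicate n)

  emptyCount-replicate : ∀ n → emptyCount (replicate n false) ≡ n
  emptyCount-replicate zero    = refl
  emptyCount-replicate (suc n) = cong suc (emptyCount-replicate n)

  occAt-replicate : ∀ n q → q < n → occAt (replicate n false) q ≡ false
  occAt-replicate (suc n) zero    _         = refl
  occAt-replicate (suc n) (suc q) (s≤s q<n) = occAt-replicate n q q<n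

  at-∷ʳ : ∀ d k (v : Vec Bool k) b → at d (v ∷ʳ b) k ≡ b
  at-∷ʳ d zero    []      b = refl
  at-∷ʳ d (suc k) (x ∷ v) b = at-∷ʳ d k v b

  at-replicate-∷ʳ : ∀ d k b q → q < k → at d (replicate k true ∷ʳ b) q ≡ true
  at-replicate-∷ʳ d (suc k) b zero    _         = refl
  at-replicate-∷ʳ d (suc k) b (suc q) (s≤s q<k) = at-replicate-∷ʳ d k b q q<k

  row-innerNapkinsAvailable : ∀ n l r → InnerNapkinsAvailable (row n l r)
  row-innerNapkinsAvailable zero    l r q () _
  row-innerNapkinsAvailable (suc k) l r q _ empty₁ =
    at-replicate-∷ʳ false k r q (≤-pred (at≡not-default⇒< true (replicate (suc k) false) (suc q) empty₁))

  runValue-row : ∀ n l r q → q ≢ 0 → runValue (row n l r) q ≡ 0ℚ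
  runValue-row n l r zero    q≢0 = ⊥-elim (q≢0 refl)
  runValue-row n l r (suc p) _ with p <? n
  ... | yes p<n = runValue-inside (replicate n false) (napRow n l r) (suc p) (occAt-replicate n p p<n)
  ... | no  p≮n = runValue-occ (replicate n false) (napRow n l r) (suc p)
                    (at-beyond true (replicate n false) (suc p) (≤-trans (≮⇒≥ p≮n) (n≤1+n p)))

  potential-row : ∀ n l r → potential (row n l r) ≡ rowValue n l r
  potential-row zero    l r = sym (rowValue-0 l r)
  potential-row (suc k) l r = begin
    potential (row (suc k) l r)                 ≡⟨ sum<-single (suc k) (runValue (row (suc k) l r)) 0 (s≤s z≤n) (runValue-row (suc k) l r) ⟩
    runValue (row (suc k) l r) 0                ≡⟨ runValue-start (replicate (suc k) false) (napRow (suc k) l r) 0 refl refl ⟩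
    rowValue (run (replicate (suc k) false) 0) l (napAt (napRow (suc k) l r) (run (replicate (suc k) false) 0))
                                                ≡⟨ cong (λ len → rowValue len l (napAt (napRow (suc k) l r) len)) (run-replicate (suc k)) ⟩
    rowValue (suc k) l (at false (replicate k true ∷ʳ r) k) ≡⟨ cong (rowValue (suc k) l) (at-∷ʳ false k (replicate k true) r) ⟩
    rowValue (suc k) l r                        ∎
    where open ≡-Reasoning

  expNapkinless-row : (c : Chooser) → FollowsS c → ∀ n l r → expNapkinless c n (row n l r) ≡ rowValue n l r
  expNapkinless-row c follows n l r = trans
    (ValueTheorem.expNapkinless≡potential c follows n (replicate n false) (napRow n l r)
      (row-innerNapkinsAvailable n l r) (≤-reflexive (emptyCount-replicate n)))
    (potential-row n l r)

open import Data.Nat using (ℕ; suc; _∸_) renaming (_<_ to _<ℕ_; _+_ to _+ℕ_)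
open import Data.Nat.Properties using (+-suc; +-comm; ∸-+-assoc; m∸n+n≡m)
open import Data.Bool using (true; false)
open import Data.Product using (_×_; _,_)
open import Data.Rational using (ℚ; ½; _+_; _*_; _≤_)
open import Relation.Binary.PropositionalEquality using (_≡_; trans; cong; module ≡-Reasoning)
open import Data.Rational.Properties using (≤-trans; ≤-reflexive)
open RowValues using (outer; asym; inner; outer-split; asym-split)
open Seating using (expNapkinless-row)

suc[n∸m∸1+m]≡n : ∀ m n → m <ℕ n → suc ((n ∸ m ∸ 1) +ℕ m) ≡ n
suc[n∸m∸1+m]≡n m n m<n = begin
  suc ((n ∸ m ∸ 1) +ℕ m)  ≡⟨ +-suc (n ∸ m ∸ 1) m ⟨
  (n ∸ m ∸ 1) +ℕ suc m    ≡⟨ cong (λ j → j +ℕ suc m) (trans (∸-+-assoc n m 1) (cong (n ∸_) (+-comm m 1))) ⟩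
  (n ∸ suc m) +ℕ suc m    ≡⟨ m∸n+n≡m m<n ⟩
  n                       ∎
  where open ≡-Reasoning

lemma5p4 : (c : Chooser) → FollowsS c → (m n : ℕ) → m <ℕ n →
    (½ * (oS c m + aS c m + oS c (n ∸ m ∸ 1) + aS c (n ∸ m ∸ 1)) ≤ oS c n)
    × (0 <ℕ n ∸ m ∸ 1 →
       ½ * (oS c m + aS c m + iS c (n ∸ m ∸ 1) + aS c (n ∸ m ∸ 1)) ≤ aS c n)
-- Part (b) holds without its positivity hypothesis: for n = m + 1 it is outer ≤ asym.
lemma5p4 c follows m n m<n = part-a , λ _ → part-b
  where
  k : ℕ
  k = n ∸ m ∸ 1
  oS≡ : ∀ j → oS c j ≡ outer j
  oS≡ j = expNapkinless-row c follows j true true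
  aS≡ : ∀ j → aS c j ≡ asym j
  aS≡ j = expNapkinless-row c follows j true false
  iS≡ : ∀ j → iS c j ≡ inner j
  iS≡ j = expNapkinless-row c follows j false false
  part-a : ½ * (oS c m + aS c m + oS c k + aS c k) ≤ oS c n
  part-a rewrite oS≡ m | aS≡ m | oS≡ k | aS≡ k | oS≡ n =
    ≤-trans (outer-split m k) (≤-reflexive (cong outer (suc[n∸m∸1+m]≡n m n m<n)))
  part-b : ½ * (oS c m + aS c m + iS c k + aS c k) ≤ aS c n
  part-b rewrite oS≡ m | aS≡ m | iS≡ k | aS≡ k | aS≡ n =
    ≤-trans (asym-split m k) (≤-reflexive (cong asym (suc[n∸m∸1+m]≡n m n m<n)))
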